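{- Let $k\ge2$, let $\mathbf a=(a_n)_{n\ge0}$ be a sequence over a finite alphabet, and let $q\in\mathbb N$. For $r\in\mathbb Z$ let $\mathbf a^{(r)}=(a_{qn+r})_{n=0}^\infty$, where $a_n:=a_0$ for $n<0$. (1) If $\mathbf a$ is asymptotically $k$-automatic, then $\mathbf a^{(r)}$ is asymptotically $k$-automatic for each $r\in\mathbb Z$. (2) If $\mathbf a^{(r)}$ is asymptotically $k$-automatic for every $r$ with $0\le r<q$, then $\mathbf a$ is asymptotically $k$-automatic.
   Context: For a sequence $\mathbf a=(a_n)_{n\ge0}$ and an integer $k\ge2$, the $k$-kernel is $\mathcal N_k(\mathbf a)=\{(a_{k^in+r})_{n=0}^\infty : i,r\in\mathbb N_0,\ r<k^i\}$. Two sequences are asymptotically equal, $\mathbf a\simeq\mathbf b$, if $\frac1N\#\{0\le n<N: a_n\ne b_n\}\to0$. A sequence over a finite alphabet is asymptotically $k$-automatic if $\mathcal N_k(\mathbf a)$ is finite up to $\simeq$ (finitely many sequences such that each kernel element is asymptotically equal to one of them). -}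

module Defs where

open import Data.Nat using (ℕ; zero; suc; _+_; _*_; _^_; _≤_; _<_)
open import Data.Fin using (Fin; _≟_)
open import Data.Integer using (ℤ; +_; -[1+_])
import Data.Integer as ℤ
open import Data.List using (List)
open import Data.List.Membership.Propositional using (_∈_)
open import Data.Product using (Σ; ∃; _×_; _,_)
open import Relation.Nullary using (yes; no)

Seq : ℕ → Set
Seq s = ℕ → Fin s

mismatches : ∀ {s} → Seq s → Seq s → ℕ → ℕ
mismatches a b zero = zero
mismatches a b (suc N) with a N ≟ b N
... | yes _ = mismatches a b N
... | no  _ = suc (mismatches a b N)

-- a ≃ b : (1/N) #{n < N : a n ≠ b n} → 0, i.e. for every ε = 1/m (m ≥ 1)
-- there is N₀ with #{...} / N ≤ 1/m for all N ≥ N₀.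
_≃_ : ∀ {s} → Seq s → Seq s → Set
a ≃ b = ∀ (m : ℕ) → 1 ≤ m →
        ∃ λ N₀ → ∀ N → N₀ ≤ N → m * mismatches a b N ≤ N

kernelSeq : ∀ {s} → ℕ → Seq s → ℕ → ℕ → Seq s
kernelSeq k a i r n = a (k ^ i * n + r)

-- N_k(a) is finite up to ≃: finitely many sequences such that every kernel
-- element is asymptotically equal to one of them.
AsympAutomatic : ∀ {s} → ℕ → Seq s → Set
AsympAutomatic {s} k a =
  ∃ λ (L : List (Seq s)) →
    ∀ (i r : ℕ) → r < k ^ i → ∃ λ b → b ∈ L × kernelSeq k a i r ≃ b

extℤ : ∀ {s} → Seq s → ℤ → Fin s
extℤ a (+ n)      = a n
extℤ a -[1+ n ]   = a 0

subseq : ∀ {s} → ℕ → Seq s → ℤ → Seq s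
subseq q a r n = extℤ a ((+ q) ℤ.* (+ n) ℤ.+ r)

{-# OPTIONS --safe #-}
-- Write K = k ^ i.  (1) The kernel element n ↦ a (q (K n + t) + r) of a^(r) agrees, for
-- n ≥ ∣ r ∣, with n ↦ x (q n + c − ∣ r ∣), where x is the kernel element (a (K n + d))ₙ and
-- d, c are remainder and quotient of q t + r + ∣ r ∣ K by K.  Since c < q + 2 ∣ r ∣, the
-- sequences b^(c − ∣ r ∣) for b a representative for a and c bounded cover the kernel of
-- a^(r): reading x ≃ b along an index map of linear growth keeps mismatch density zero.
-- (2) The j-th residue class mod q of (a (K n + t))ₙ is the kernel element of a^(v) at
-- (i, u), where K j + t = v + u q; interleaving q representatives of these classes gives a
-- representative, as the mismatch count of an interleaving is the sum over its classes.
module Submission where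

open import Defs
open import Data.Nat using (ℕ; zero; suc; _+_; _*_; _∸_; _^_; _≤_; _<_; _≤′_; ≤′-refl; ≤′-step;
  z≤n; s≤s; _≤?_; _⊔_; NonZero; >-nonZero; >-nonZero⁻¹)
open import Data.Nat.Properties hiding (_≟_)
open import Data.Nat.DivMod
open import Data.Nat.Divisibility using (n∣m*n)
open import Data.Nat.Tactic.RingSolver using (solve-∀)
open import Data.Integer using (ℤ; +_; -[1+_]; ∣_∣; _⊖_)
import Data.Integer as ℤ
open import Data.Integer.Properties using (pos-+; pos-*; ⊖-≥; m-n≡m⊖n)
import Data.Integer.Tactic.RingSolver as ℤ-Ring
open import Data.Fin using (Fin; toℕ; _≟_)
import Data.Fin as Fin
open import Data.Fin.Properties using (toℕ<n; toℕ-fromℕ<; toℕ-injective)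
open import Data.Vec using (Vec; []; _∷_; lookup; tabulate)
open import Data.Vec.Properties using (lookup∘tabulate)
open import Data.List using (List; [_]; cartesianProductWith; concat; map; allFin; upTo)
open import Data.List.Relation.Unary.Any using (here)
open import Data.List.Membership.Propositional using (_∈_)
open import Data.List.Membership.Propositional.Properties
  using (∈-cartesianProductWith⁺; ∈-concat⁺′; ∈-map⁺; ∈-allFin; ∈-upTo⁺)
open import Algebra.Properties.CommutativeMonoid.Sum +-0-commutativeMonoid
  using (sum-syntax; ∑-distrib-+; sum-cong-≗; sum-replicate-zero)
open import Algebra.Properties.CommutativeSemigroup +-commutativeSemigroup using (x∙yz≈y∙xz)
open import Data.Product using (∃; _×_; _,_; proj₁; proj₂)
open import Relation.Nullary using (yes; no)
open import Relation.Binary.PropositionalEquality hiding ([_])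

differs : ∀ {s} → Fin s → Fin s → ℕ
differs x y with x ≟ y
... | yes _ = 0
... | no  _ = 1

differs≤1 : ∀ {s} (x y : Fin s) → differs x y ≤ 1
differs≤1 x y with x ≟ y
... | yes _ = z≤n
... | no  _ = s≤s z≤n

mismatches-suc : ∀ {s} (x y : Seq s) N →
  mismatches x y (suc N) ≡ differs (x N) (y N) + mismatches x y N
mismatches-suc x y N with x N ≟ y N
... | yes _ = refl
... | no  _ = refl

mismatches≤ : ∀ {s} (x y : Seq s) N → mismatches x y N ≤ N
mismatches≤ x y zero = z≤n
mismatches≤ x y (suc N) rewrite mismatches-suc x y N =
  +-mono-≤ (differs≤1 (x N) (y N)) (mismatches≤ x y N)

mismatches-mono : ∀ {s} (x y : Seq s) {N M} → N ≤ M → mismatches x y N ≤ mismatches x y M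
mismatches-mono x y {N} N≤M = go (≤⇒≤′ N≤M)
  where
  go : ∀ {M} → N ≤′ M → mismatches x y N ≤ mismatches x y M
  go ≤′-refl = ≤-refl
  go (≤′-step {M} N≤′M) rewrite mismatches-suc x y M = ≤-trans (go N≤′M) (m≤n+m _ _)

mismatches-cong : ∀ {s} {X Y x y : Seq s} → X ≗ x → Y ≗ y → mismatches X Y ≗ mismatches x y
mismatches-cong X≗x Y≗y zero = refl
mismatches-cong {X = X} {Y} {x} {y} X≗x Y≗y (suc N)
  rewrite mismatches-suc X Y N | mismatches-suc x y N | X≗x N | Y≗y N
        | mismatches-cong X≗x Y≗y N = refl

mismatches-+ : ∀ {s} (x y : Seq s) M B →
  mismatches x y (M + B) ≡ ∑[ j < B ] differs (x (M + toℕ j)) (y (M + toℕ j)) + mismatches x y M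
mismatches-+ x y M zero = cong (mismatches x y) (+-identityʳ M)
mismatches-+ x y M (suc B) = begin
  mismatches x y (M + suc B)                 ≡⟨ cong (mismatches x y) (+-suc M B) ⟩
  mismatches x y (suc M + B)                 ≡⟨ mismatches-+ x y (suc M) B ⟩
  ∑′ + mismatches x y (suc M)                ≡⟨ cong₂ _+_ (sum-cong-≗ {B} shift) (mismatches-suc x y M) ⟩
  ∑″ + (differs (x M) (y M) + mismatches x y M)
    ≡⟨ cong (λ m → ∑″ + (differs (x m) (y m) + mismatches x y M)) (sym (+-identityʳ M)) ⟩
  ∑″ + (δ₀ + mismatches x y M)               ≡⟨ rearrange ∑″ δ₀ (mismatches x y M) ⟩
  (δ₀ + ∑″) + mismatches x y M               ∎
  where
  open ≡-Reasoning
  δ₀ = differs (x (M + 0)) (y (M + 0))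
  ∑′ = ∑[ j < B ] differs (x (suc M + toℕ j)) (y (suc M + toℕ j))
  ∑″ = ∑[ j < B ] differs (x (M + suc (toℕ j))) (y (M + suc (toℕ j)))
  shift : ∀ j → differs (x (suc M + toℕ j)) (y (suc M + toℕ j))
              ≡ differs (x (M + suc (toℕ j))) (y (M + suc (toℕ j)))
  shift j = cong (λ m → differs (x m) (y m)) (sym (+-suc M (toℕ j)))
  rearrange : ∀ a b c → a + (b + c) ≡ (b + a) + c
  rearrange = solve-∀

-- x ≃ y is, by definition, Negligible (mismatches x y).
Negligible : (ℕ → ℕ) → Set
Negligible c = ∀ m → 1 ≤ m → ∃ λ N₀ → ∀ N → N₀ ≤ N → m * c N ≤ N

negligible-≤ : ∀ {c c′ : ℕ → ℕ} → (∀ N → c N ≤ c′ N) → Negligible c′ → Negligible c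
negligible-≤ c≤c′ neg m 1≤m with neg m 1≤m
... | N₀ , bound = N₀ , λ N N₀≤N → ≤-trans (*-monoʳ-≤ m (c≤c′ N)) (bound N N₀≤N)

negligible-const : ∀ C → Negligible (λ _ → C)
negligible-const C m _ = m * C , λ N mC≤N → mC≤N

negligible-+ : ∀ {c c′ : ℕ → ℕ} → Negligible c → Negligible c′ → Negligible (λ N → c N + c′ N)
negligible-+ {c} {c′} neg neg′ m 1≤m with neg (2 * m) 1≤2m | neg′ (2 * m) 1≤2m
  where 1≤2m = ≤-trans 1≤m (m≤n*m m 2)
... | N₁ , bound₁ | N₂ , bound₂ = N₁ ⊔ N₂ , λ N N₁⊔N₂≤N → *-cancelˡ-≤ 2 (begin
  2 * (m * (c N + c′ N))      ≡⟨ distribute m (c N) (c′ N) ⟩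
  2 * m * c N + 2 * m * c′ N  ≤⟨ +-mono-≤ (bound₁ N (m⊔n≤o⇒m≤o N₁ N₂ N₁⊔N₂≤N))
                                          (bound₂ N (m⊔n≤o⇒n≤o N₁ N₂ N₁⊔N₂≤N)) ⟩
  N + N                       ≡⟨ cong (λ n → N + n) (sym (+-identityʳ N)) ⟩
  2 * N                       ∎)
  where
  open ≤-Reasoning
  distribute : ∀ m a b → 2 * (m * (a + b)) ≡ 2 * m * a + 2 * m * b
  distribute = solve-∀

negligible-sum : ∀ J {c : Fin J → ℕ → ℕ} → (∀ j → Negligible (c j)) →
  Negligible (λ N → ∑[ j < J ] c j N)
negligible-sum zero    neg = negligible-const 0
negligible-sum (suc J) neg = negligible-+ (neg Fin.zero) (negligible-sum J (λ j → neg (Fin.suc j)))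

negligible-affine : ∀ {c : ℕ → ℕ} q .{{_ : NonZero q}} D → Negligible c →
  Negligible (λ N → c (q * N + D))
negligible-affine {c} q D neg m 1≤m with neg (m * suc q) (*-mono-≤ 1≤m (s≤s z≤n))
... | N₀ , bound = N₀ ⊔ D , λ N N₀⊔D≤N → *-cancelˡ-≤ (suc q) (begin
  suc q * (m * c (q * N + D))  ≡⟨ reassociate (suc q) m (c (q * N + D)) ⟩
  m * suc q * c (q * N + D)    ≤⟨ bound (q * N + D) (N₀≤ N N₀⊔D≤N) ⟩
  q * N + D                    ≤⟨ +-monoʳ-≤ (q * N) (m⊔n≤o⇒n≤o N₀ D N₀⊔D≤N) ⟩
  q * N + N                    ≡⟨ +-comm (q * N) N ⟩
  suc q * N                    ∎)
  where
  open ≤-Reasoning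
  reassociate : ∀ a b c → a * (b * c) ≡ b * a * c
  reassociate = solve-∀
  N₀≤ : ∀ N → N₀ ⊔ D ≤ N → N₀ ≤ q * N + D
  N₀≤ N N₀⊔D≤N = ≤-trans (m⊔n≤o⇒m≤o N₀ D N₀⊔D≤N) (≤-trans (m≤n*m N q) (m≤m+n (q * N) D))

≃-cong : ∀ {s} {X Y x y : Seq s} → X ≗ x → Y ≗ y → x ≃ y → X ≃ Y
≃-cong X≗x Y≗y = negligible-≤ (λ N → ≤-reflexive (mismatches-cong X≗x Y≗y N))

mismatches-along : ∀ {s} {X Y x y : Seq s} (f : ℕ → ℕ) C →
  (∀ n → C ≤ n → f n < f (suc n)) →
  (∀ n → C ≤ n → X n ≡ x (f n)) → (∀ n → C ≤ n → Y n ≡ y (f n)) →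
  ∀ N → mismatches X Y N ≤ C + mismatches x y (f N)
mismatches-along f C increasing X≡ Y≡ zero = z≤n
mismatches-along {X = X} {Y} {x} {y} f C increasing X≡ Y≡ (suc N) with C ≤? N
... | no C≰N = ≤-trans (mismatches≤ X Y (suc N)) (≤-trans (≰⇒> C≰N) (m≤m+n C _))
... | yes C≤N = begin
  mismatches X Y (suc N)                            ≡⟨ mismatches-suc X Y N ⟩
  differs (X N) (Y N) + mismatches X Y N
    ≤⟨ +-monoʳ-≤ _ (mismatches-along f C increasing X≡ Y≡ N) ⟩
  differs (X N) (Y N) + (C + mismatches x y (f N))
    ≡⟨ cong₂ (λ u v → differs u v + (C + mismatches x y (f N))) (X≡ N C≤N) (Y≡ N C≤N) ⟩
  differs (x (f N)) (y (f N)) + (C + mismatches x y (f N))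
    ≡⟨ x∙yz≈y∙xz (differs (x (f N)) (y (f N))) C (mismatches x y (f N)) ⟩
  C + (differs (x (f N)) (y (f N)) + mismatches x y (f N))
    ≡⟨ cong (λ n → C + n) (mismatches-suc x y (f N)) ⟨
  C + mismatches x y (suc (f N))
    ≤⟨ +-monoʳ-≤ C (mismatches-mono x y (increasing N C≤N)) ⟩
  C + mismatches x y (f (suc N))                    ∎
  where open ≤-Reasoning

≃-along : ∀ {s} {X Y x y : Seq s} (f : ℕ → ℕ) q .{{_ : NonZero q}} D C →
  (∀ n → C ≤ n → f n < f (suc n)) → (∀ N → f N ≤ q * N + D) →
  (∀ n → C ≤ n → X n ≡ x (f n)) → (∀ n → C ≤ n → Y n ≡ y (f n)) →
  x ≃ y → X ≃ Y
≃-along {x = x} {y} f q D C increasing f≤ X≡ Y≡ x≃y =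
  negligible-≤ (λ N → ≤-trans (mismatches-along f C increasing X≡ Y≡ N)
                               (+-monoʳ-≤ C (mismatches-mono x y (f≤ N))))
               (negligible-+ (negligible-const C) (negligible-affine q D x≃y))

subseq-+ : ∀ {s} q (x : Seq s) r n → subseq q x (+ r) n ≡ x (q * n + r)
subseq-+ q x r n = cong (λ i → extℤ x (i ℤ.+ + r)) (sym (pos-* q n))

mismatches-* : ∀ {s} (X Y : Seq s) q N →
  mismatches X Y (q * N) ≡ ∑[ j < q ] mismatches (subseq q X (+ toℕ j)) (subseq q Y (+ toℕ j)) N
mismatches-* X Y q zero = trans (cong (mismatches X Y) (*-zeroʳ q)) (sym (sum-replicate-zero q))
mismatches-* X Y q (suc N) = begin
  mismatches X Y (q * suc N)      ≡⟨ cong (mismatches X Y) (trans (*-suc q N) (+-comm q (q * N))) ⟩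
  mismatches X Y (q * N + q)      ≡⟨ mismatches-+ X Y (q * N) q ⟩
  ∑[ j < q ] δ j + mismatches X Y (q * N)   ≡⟨ cong (λ n → ∑[ j < q ] δ j + n) (mismatches-* X Y q N) ⟩
  ∑[ j < q ] δ j + ∑[ j < q ] μ j N         ≡⟨ ∑-distrib-+ δ (λ j → μ j N) ⟨
  ∑[ j < q ] (δ j + μ j N)                  ≡⟨ sum-cong-≗ {q} step ⟩
  ∑[ j < q ] μ j (suc N)                    ∎
  where
  open ≡-Reasoning
  δ : Fin q → ℕ
  δ j = differs (X (q * N + toℕ j)) (Y (q * N + toℕ j))
  μ : Fin q → ℕ → ℕ
  μ j = mismatches (subseq q X (+ toℕ j)) (subseq q Y (+ toℕ j))
  step : ∀ j → δ j + μ j N ≡ μ j (suc N)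
  step j = sym (trans (mismatches-suc (subseq q X (+ toℕ j)) (subseq q Y (+ toℕ j)) N)
                      (cong (_+ μ j N) (cong₂ differs (subseq-+ q X (toℕ j) N) (subseq-+ q Y (toℕ j) N))))

≃-of-residues : ∀ {s} q .{{_ : NonZero q}} {X Y : Seq s} →
  (∀ j → subseq q X (+ toℕ j) ≃ subseq q Y (+ toℕ j)) → X ≃ Y
≃-of-residues q {X} {Y} residues≃ =
  negligible-≤ (λ N → ≤-trans (mismatches-mono X Y (m≤n*m N q))
                              (≤-reflexive (mismatches-* X Y q N)))
               (negligible-sum q residues≃)

-- r + S as a natural number; truncated to 0 when S < ∣ r ∣.
liftBy : ℤ → ℕ → ℕ
liftBy (+ r)    S = r + S
liftBy -[1+ r ] S = S ∸ suc r

liftBy-≤ : ∀ r S → liftBy r S ≤ ∣ r ∣ + S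
liftBy-≤ (+ r)    S = ≤-refl
liftBy-≤ -[1+ r ] S = ≤-trans (m∸n≤m S (suc r)) (m≤n+m S (suc r))

+liftBy : ∀ r S → ∣ r ∣ ≤ S → + liftBy r S ≡ r ℤ.+ + S
+liftBy (+ r)    S _   = pos-+ r S
+liftBy -[1+ r ] S r<S = sym (⊖-≥ r<S)

liftBy-difference : ∀ r S → ∣ r ∣ ≤ S → r ≡ + liftBy r S ℤ.- + S
liftBy-difference r S ∣r∣≤S = begin
  r                     ≡⟨ add-sub r (+ S) ⟩
  r ℤ.+ + S ℤ.- + S     ≡⟨ cong (ℤ._- + S) (+liftBy r S ∣r∣≤S) ⟨
  + liftBy r S ℤ.- + S  ∎
  where
  open ≡-Reasoning
  add-sub : ∀ a b → a ≡ a ℤ.+ b ℤ.- b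
  add-sub = ℤ-Ring.solve-∀

subseq-difference : ∀ {s} q (x : Seq s) R S n → S ≤ q * n + R →
  subseq q x (+ R ℤ.- + S) n ≡ x (q * n + R ∸ S)
subseq-difference q x R S n S≤ = cong (extℤ x) (begin
  + q ℤ.* + n ℤ.+ (+ R ℤ.- + S)    ≡⟨ reassociate (+ q ℤ.* + n) (+ R) (+ S) ⟩
  + q ℤ.* + n ℤ.+ + R ℤ.- + S      ≡⟨ cong (λ i → i ℤ.+ + R ℤ.- + S) (pos-* q n) ⟨
  + (q * n + R) ℤ.- + S            ≡⟨ m-n≡m⊖n (q * n + R) S ⟩
  (q * n + R) ⊖ S                  ≡⟨ ⊖-≥ S≤ ⟩
  + (q * n + R ∸ S)                ∎)
  where
  open ≡-Reasoning
  reassociate : ∀ a b c → a ℤ.+ (b ℤ.- c) ≡ a ℤ.+ b ℤ.- c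
  reassociate = ℤ-Ring.solve-∀

k*m+d∸p*k≡k*[m∸p]+d : ∀ k m d p → p ≤ m → k * m + d ∸ p * k ≡ k * (m ∸ p) + d
k*m+d∸p*k≡k*[m∸p]+d k m d p p≤m = begin
  k * m + d ∸ p * k    ≡⟨ cong (k * m + d ∸_) (*-comm p k) ⟩
  k * m + d ∸ k * p    ≡⟨ +-∸-comm d (*-monoʳ-≤ k p≤m) ⟩
  k * m ∸ k * p + d    ≡⟨ cong (_+ d) (*-distribˡ-∸ k m p) ⟨
  k * (m ∸ p) + d      ∎
  where open ≡-Reasoning

a*[b*n+t]+r≡b*[a*n+c]+d : ∀ a b n t r d c → a * t + r ≡ d + c * b →
  a * (b * n + t) + r ≡ b * (a * n + c) + d
a*[b*n+t]+r≡b*[a*n+c]+d a b n t r d c division = begin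
  a * (b * n + t) + r        ≡⟨ expand a b n t r ⟩
  b * (a * n) + (a * t + r)  ≡⟨ cong (λ m → b * (a * n) + m) division ⟩
  b * (a * n) + (d + c * b)  ≡⟨ collect a b n d c ⟩
  b * (a * n + c) + d        ∎
  where
  open ≡-Reasoning
  expand : ∀ a b n t r → a * (b * n + t) + r ≡ b * (a * n) + (a * t + r)
  expand = solve-∀
  collect : ∀ a b n d c → b * (a * n) + (d + c * b) ≡ b * (a * n + c) + d
  collect = solve-∀

kernelSeq-subseq : ∀ {s} k .{{_ : NonZero k}} (a : Seq s) q r i t {d c} →
  q * t + liftBy r (∣ r ∣ * k ^ i) ≡ d + c * k ^ i →
  ∀ n → ∣ r ∣ ≤ q * n + c →
  kernelSeq k (subseq q a r) i t n ≡ kernelSeq k a i d (q * n + c ∸ ∣ r ∣)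
kernelSeq-subseq k a q r i t {d} {c} division n P≤ = begin
  subseq q a r (K * n + t)
    ≡⟨ cong (λ r → subseq q a r (K * n + t)) (liftBy-difference r S (m≤m*n P K)) ⟩
  subseq q a (+ R ℤ.- + S) (K * n + t)  ≡⟨ subseq-difference q a R S (K * n + t) S≤ ⟩
  a (q * (K * n + t) + R ∸ S)           ≡⟨ cong (λ m → a (m ∸ S)) index ⟩
  a (K * (q * n + c) + d ∸ P * K)       ≡⟨ cong a (k*m+d∸p*k≡k*[m∸p]+d K (q * n + c) d P P≤) ⟩
  a (K * (q * n + c ∸ P) + d)           ∎
  where
  open ≡-Reasoning
  K = k ^ i
  instance
    K≢0 : NonZero K
    K≢0 = m^n≢0 k i
  P = ∣ r ∣
  S = P * K
  R = liftBy r S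
  index : q * (K * n + t) + R ≡ K * (q * n + c) + d
  index = a*[b*n+t]+r≡b*[a*n+c]+d q K n t R d c division
  S≤ : S ≤ q * (K * n + t) + R
  S≤ = subst (S ≤_) (sym index)
         (≤-trans (≤-reflexive (*-comm P K)) (≤-trans (*-monoʳ-≤ K P≤) (m≤m+n _ d)))

subseq-asympAutomatic : ∀ {s} k .{{_ : NonZero k}} (a : Seq s) q .{{_ : NonZero q}} →
  AsympAutomatic k a → ∀ r → AsympAutomatic k (subseq q a r)
subseq-asympAutomatic {s} k a q (L , approx) r = reps , approx′
  where
  P = ∣ r ∣
  shifted : Seq s → ℕ → Seq s
  shifted b c = subseq q b (+ c ℤ.- + P)
  reps : List (Seq s)
  reps = cartesianProductWith shifted L (upTo (q + P + P))
  approx′ : ∀ i t → t < k ^ i → ∃ λ b → b ∈ reps × kernelSeq k (subseq q a r) i t ≃ b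
  approx′ i t t<K = from (approx i d (m%n<n w K))
    where
    K = k ^ i
    instance
      K≢0 : NonZero K
      K≢0 = m^n≢0 k i
    w = q * t + liftBy r (P * K)
    d = w % K
    c = w / K
    c<bound : c < q + P + P
    c<bound = m<n*o⇒m/o<n (begin-strict
      q * t + liftBy r (P * K) <⟨ +-monoˡ-< _ (*-monoʳ-< q t<K) ⟩
      q * K + liftBy r (P * K) ≤⟨ +-monoʳ-≤ (q * K) (liftBy-≤ r (P * K)) ⟩
      q * K + (P + P * K)      ≤⟨ +-monoʳ-≤ (q * K) (+-monoˡ-≤ (P * K) (m≤m*n P K)) ⟩
      q * K + (P * K + P * K)  ≡⟨ collect q P K ⟩
      (q + P + P) * K          ∎)
      where
      open ≤-Reasoning
      collect : ∀ q P K → q * K + (P * K + P * K) ≡ (q + P + P) * K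
      collect = solve-∀
    P≤ : ∀ n → P ≤ n → P ≤ q * n + c
    P≤ n P≤n = ≤-trans P≤n (≤-trans (m≤n*m n q) (m≤m+n (q * n) c))
    f : ℕ → ℕ
    f n = q * n + c ∸ P
    increasing : ∀ n → P ≤ n → f n < f (suc n)
    increasing n P≤n = begin-strict
      f n                    <⟨ m<n+m (f n) (>-nonZero⁻¹ q) ⟩
      q + f n                ≡⟨ +-∸-assoc q (P≤ n P≤n) ⟨
      q + (q * n + c) ∸ P    ≡⟨ cong (_∸ P) (sym (+-assoc q (q * n) c)) ⟩
      q + q * n + c ∸ P      ≡⟨ cong (λ m → m + c ∸ P) (*-suc q n) ⟨
      f (suc n)              ∎
      where open ≤-Reasoning
    from : (∃ λ b → b ∈ L × kernelSeq k a i d ≃ b) →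
           ∃ λ b → b ∈ reps × kernelSeq k (subseq q a r) i t ≃ b
    from (b , b∈L , x≃b) =
      shifted b c , ∈-cartesianProductWith⁺ shifted b∈L (∈-upTo⁺ c<bound) ,
      ≃-along f q c P increasing (λ N → m∸n≤m (q * N + c) P)
        (λ n P≤n → kernelSeq-subseq k a q r i t (m≡m%n+[m/n]*n w K) n (P≤ n P≤n))
        (λ n P≤n → subseq-difference q b c P n (P≤ n P≤n))
        x≃b

interleave : ∀ {s} q .{{_ : NonZero q}} → Vec (Seq s) q → Seq s
interleave q xs n = lookup xs (n mod q) (n div q)

subseq-interleave : ∀ {s} q .{{_ : NonZero q}} (xs : Vec (Seq s) q) j →
  subseq q (interleave q xs) (+ toℕ j) ≗ lookup xs j
subseq-interleave q xs j n = begin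
  subseq q (interleave q xs) (+ toℕ j) n  ≡⟨ subseq-+ q (interleave q xs) (toℕ j) n ⟩
  lookup xs (m mod q) (m div q)           ≡⟨ cong₂ (λ j′ n′ → lookup xs j′ n′) remainder quotient ⟩
  lookup xs j n                           ∎
  where
  open ≡-Reasoning
  m = q * n + toℕ j
  m≡ : m ≡ toℕ j + n * q
  m≡ = trans (+-comm (q * n) (toℕ j)) (cong (λ p → toℕ j + p) (*-comm q n))
  remainder : m mod q ≡ j
  remainder = toℕ-injective (begin
    toℕ (m mod q)        ≡⟨ toℕ-fromℕ< (m%n<n m q) ⟩
    m % q                ≡⟨ %-congˡ m≡ ⟩
    (toℕ j + n * q) % q  ≡⟨ [m+kn]%n≡m%n (toℕ j) n q ⟩
    toℕ j % q            ≡⟨ m<n⇒m%n≡m (toℕ<n j) ⟩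
    toℕ j                ∎)
  quotient : m div q ≡ n
  quotient = begin
    m / q                      ≡⟨ /-congˡ m≡ ⟩
    (toℕ j + n * q) / q        ≡⟨ +-distrib-/-∣ʳ (toℕ j) (n∣m*n n) ⟩
    toℕ j / q + n * q / q      ≡⟨ cong₂ _+_ (m<n⇒m/n≡0 (toℕ<n j)) (m*n/n≡m n q) ⟩
    n                          ∎

allVecs : ∀ {A : Set} → List A → (n : ℕ) → List (Vec A n)
allVecs L zero    = [ [] ]
allVecs L (suc n) = cartesianProductWith _∷_ L (allVecs L n)

tabulate∈allVecs : ∀ {A : Set} (L : List A) n (g : Fin n → A) → (∀ j → g j ∈ L) →
  tabulate g ∈ allVecs L n
tabulate∈allVecs L zero    g g∈L = here refl
tabulate∈allVecs L (suc n) g g∈L =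
  ∈-cartesianProductWith⁺ _∷_ (g∈L Fin.zero)
    (tabulate∈allVecs L n (λ j → g (Fin.suc j)) (λ j → g∈L (Fin.suc j)))

kernelSeq-residue : ∀ {s} k (a : Seq s) q i t j {v u} → k ^ i * j + t ≡ v + u * q →
  subseq q (kernelSeq k a i t) (+ j) ≗ kernelSeq k (subseq q a (+ v)) i u
kernelSeq-residue k a q i t j {v} {u} division n = begin
  subseq q (kernelSeq k a i t) (+ j) n  ≡⟨ subseq-+ q (kernelSeq k a i t) j n ⟩
  a (K * (q * n + j) + t)               ≡⟨ cong a (a*[b*n+t]+r≡b*[a*n+c]+d K q n j t v u division) ⟩
  a (q * (K * n + u) + v)               ≡⟨ subseq-+ q a v (K * n + u) ⟨
  subseq q a (+ v) (K * n + u)          ∎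
  where
  open ≡-Reasoning
  K = k ^ i

asympAutomatic-of-subseqs : ∀ {s} k (a : Seq s) q .{{_ : NonZero q}} →
  (∀ r → r < q → AsympAutomatic k (subseq q a (+ r))) → AsympAutomatic k a
asympAutomatic-of-subseqs {s} k a q residueAutomatic = reps , approx
  where
  repsOf : Fin q → List (Seq s)
  repsOf v = proj₁ (residueAutomatic (toℕ v) (toℕ<n v))
  residueReps : List (Seq s)
  residueReps = concat (map repsOf (allFin q))
  reps : List (Seq s)
  reps = map (interleave q) (allVecs residueReps q)
  approx : ∀ i t → t < k ^ i → ∃ λ b → b ∈ reps × kernelSeq k a i t ≃ b
  approx i t t<K =
    interleave q (tabulate g) ,
    ∈-map⁺ (interleave q) (tabulate∈allVecs residueReps q g (λ j → proj₁ (proj₂ (choice j)))) ,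
    ≃-of-residues q residues≃
    where
    K = k ^ i
    X = kernelSeq k a i t
    choice : ∀ j → ∃ λ b → b ∈ residueReps × subseq q X (+ toℕ j) ≃ b
    choice j = from (proj₂ (residueAutomatic (toℕ v) (toℕ<n v)) i u u<K)
      where
      open DivMod ((K * toℕ j + t) divMod q)
        using () renaming (remainder to v; quotient to u; property to division)
      u<K : u < K
      u<K = m<n*o⇒m/o<n (begin-strict
        K * toℕ j + t  <⟨ +-monoʳ-< (K * toℕ j) t<K ⟩
        K * toℕ j + K  ≡⟨ +-comm (K * toℕ j) K ⟩
        K + K * toℕ j  ≡⟨ *-suc K (toℕ j) ⟨
        K * suc (toℕ j) ≤⟨ *-monoʳ-≤ K (toℕ<n j) ⟩
        K * q          ∎)
        where open ≤-Reasoning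
      from : (∃ λ b → b ∈ repsOf v × kernelSeq k (subseq q a (+ toℕ v)) i u ≃ b) →
             ∃ λ b → b ∈ residueReps × subseq q X (+ toℕ j) ≃ b
      from (b , b∈ , kernel≃b) =
        b , ∈-concat⁺′ b∈ (∈-map⁺ repsOf (∈-allFin v)) ,
        ≃-cong (kernelSeq-residue k a q i t (toℕ j) division) (λ _ → refl) kernel≃b
    g : Fin q → Seq s
    g j = proj₁ (choice j)
    residues≃ : ∀ j → subseq q X (+ toℕ j) ≃ subseq q (interleave q (tabulate g)) (+ toℕ j)
    residues≃ j = ≃-cong (λ _ → refl)
      (λ n → trans (subseq-interleave q (tabulate g) j n) (cong (λ x → x n) (lookup∘tabulate g j)))
      (proj₂ (proj₂ (choice j)))

lemma2p5 : ∀ (k : ℕ) → 2 ≤ k → ∀ {s : ℕ} (a : Seq s) (q : ℕ) → 1 ≤ q →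
    ((AsympAutomatic k a → ∀ (r : ℤ) → AsympAutomatic k (subseq q a r))
    × ((∀ (r : ℕ) → r < q → AsympAutomatic k (subseq q a (+ r))) → AsympAutomatic k a))
lemma2p5 k 2≤k a q@(suc _) _ = subseq-asympAutomatic k a q , asympAutomatic-of-subseqs k a q
  where
  instance
    k≢0 : NonZero k
    k≢0 = >-nonZero (≤-trans (s≤s z≤n) 2≤k)
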